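{- A transitive avoidance game in which some line has size $2$ is not a Player I win.
   Context: An avoidance game consists of a finite set $X$ (the board) and a family $\mathcal{L}$ of subsets of $X$ (the lines). Two players, Player I and Player II, alternately claim previously unclaimed points of $X$, Player I moving first. The first player to have claimed all points of some line loses; if all points have been claimed and neither player has completed a line, the game is a draw. The game is transitive if its automorphism group (the group of permutations of $X$ mapping $\mathcal{L}$ onto $\mathcal{L}$) acts transitively on $X$. The game is a Player I win if Player I has a strategy guaranteeing that Player II loses. -}

module Defs where

open import Data.Nat using (ℕ)
open import Data.Fin using (Fin)
open import Data.Fin.Subset as S using (Subset; _⊆_; _∪_; ⁅_⁆; _∉_; ∣_∣)
open import Data.Fin.Permutation using (Permutation′; _⟨$⟩ʳ_; _⟨$⟩ˡ_)
open import Data.Vec using (tabulate; lookup)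
open import Data.List using (List)
open import Data.List.Membership.Propositional using () renaming (_∈_ to _∈ₗ_)
open import Data.Sum using (_⊎_)
open import Data.Product using (Σ; ∃; _×_; _,_)
open import Relation.Binary.PropositionalEquality using (_≡_)
open import Relation.Nullary using (¬_)

record AvoidanceGame : Set where
  constructor game
  field
    size  : ℕ
    lines : List (Subset size)

open AvoidanceGame public

image : ∀ {n} → Permutation′ n → Subset n → Subset n
image π L = tabulate (λ y → lookup L (π ⟨$⟩ˡ y))

IsAutomorphism : (G : AvoidanceGame) → Permutation′ (size G) → Set
IsAutomorphism G σ =
  (∀ L → L ∈ₗ lines G → image σ L ∈ₗ lines G) ×
  (∀ L → L ∈ₗ lines G → Σ (Subset (size G)) λ L′ → L′ ∈ₗ lines G × image σ L′ ≡ L)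

Transitive : AvoidanceGame → Set
Transitive G = ∀ (x y : Fin (size G)) →
  Σ (Permutation′ (size G)) λ σ → IsAutomorphism G σ × σ ⟨$⟩ʳ x ≡ y

Completes : (G : AvoidanceGame) → Subset (size G) → Set
Completes G S = Σ (Subset (size G)) λ L → L ∈ₗ lines G × L ⊆ S

-- Positions: A = points claimed by Player I, B = points claimed by Player II;
-- no line has been completed so far.
-- IWinI G A B  : Player I, to move at (A , B), can force Player II to lose.
-- IWinII G A B : Player II is to move at (A , B) and Player I can force
--                Player II to lose.
mutual
  data IWinI (G : AvoidanceGame) (A B : Subset (size G)) : Set where
    move : (x : Fin (size G)) → x ∉ A → x ∉ B →
           ¬ Completes G (A ∪ ⁅ x ⁆) →
           IWinII G (A ∪ ⁅ x ⁆) B → IWinI G A B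

  data IWinII (G : AvoidanceGame) (A B : Subset (size G)) : Set where
    -- there must be a legal move for Player II (a full board is a draw),
    -- and every legal move of Player II either completes a line (II loses)
    -- or leads to a position that is again a Player I win.
    respond : (x₀ : Fin (size G)) → x₀ ∉ A → x₀ ∉ B →
              (∀ (x : Fin (size G)) → x ∉ A → x ∉ B →
                 Completes G (B ∪ ⁅ x ⁆) ⊎ IWinI G A (B ∪ ⁅ x ⁆)) →
              IWinII G A B


PlayerIWin : AvoidanceGame → Set
PlayerIWin G = IWinI G S.⊥ S.⊥

module Submission where

-- Suppose Player I opens at p.  By transitivity some automorphism maps a
-- point of the 2-line {a , b} to p, so p lies on a 2-line {p , y}, and a
-- second automorphism τ maps p to y.  Player II answers at y.
--   * Symmetry: winning positions and completed lines are invariant under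
--     automorphisms, so the position "Player I holds {y}, Player II to move"
--     is again a Player I win, and, as {p} completes no line, neither does {y}.
--   * Strategy stealing: Player II now holds {y} and copies the winning
--     strategy for the holder of {y} in that mirrored game.  Player I's
--     real holding exceeds the mirrored opponent's only by the point p,
--     which the copied strategy never claims because p would complete the
--     line {p , y}.  Hence Player I cannot win after the reply y.

open import Defs
open import Data.Fin.Subset using (∣_∣)
open import Data.List.Membership.Propositional using () renaming (_∈_ to _∈ₗ_)
open import Data.Product using (Σ; _×_)
open import Relation.Binary.PropositionalEquality using (_≡_)
open import Relation.Nullary using (¬_)

open import Data.Nat using (ℕ; pred)
open import Data.Fin using (Fin; zero; suc)
open import Data.Fin.Subset using (Subset; _⊆_; _∪_; ⁅_⁆; _∈_; _∉_; ⊥; inside; outside)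
open import Data.Fin.Subset.Properties
  using (∉⊥; x∈⁅x⁆; x∈⁅y⁆⇒x≡y; p⊆p∪q; q⊆p∪q; x∈p∪q⁻; x∈p∪q⁺; ⊆-refl; ⊆-trans; ⊆-min; out⊆; in⊆in)
open import Data.Fin.Permutation using (Permutation′; _⟨$⟩ʳ_; _⟨$⟩ˡ_; inverseˡ; inverseʳ)
open import Data.Vec using (_∷_; []; lookup)
open import Data.Vec.Properties using (lookup∘tabulate; []=⇒lookup; lookup⇒[]=)
open import Data.Product using (_,_; proj₁; proj₂)
open import Data.Sum using (_⊎_; inj₁; inj₂)
open import Data.Empty using (⊥-elim)
import Data.Sum as Sum
open import Relation.Binary.PropositionalEquality using (_≢_; refl; sym; trans; cong; subst; module ≡-Reasoning)
open ≡-Reasoning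

∪-least : ∀ {n} {p q r : Subset n} → p ⊆ r → q ⊆ r → p ∪ q ⊆ r
∪-least {p = p} {q} p⊆r q⊆r x∈p∪q with x∈p∪q⁻ p q x∈p∪q
... | inj₁ x∈p = p⊆r x∈p
... | inj₂ x∈q = q⊆r x∈q

∪-monoˡ : ∀ {n} {p q : Subset n} (r : Subset n) → p ⊆ q → p ∪ r ⊆ q ∪ r
∪-monoˡ {q = q} r p⊆q = ∪-least (⊆-trans p⊆q (p⊆p∪q r)) (q⊆p∪q q r)

∈-∪⁅⁆⁻ : ∀ {n} {p : Subset n} {x y : Fin n} → x ∈ p ∪ ⁅ y ⁆ → x ∈ p ⊎ x ≡ y
∈-∪⁅⁆⁻ {p = p} {y = y} x∈ = Sum.map₂ (x∈⁅y⁆⇒x≡y y) (x∈p∪q⁻ p ⁅ y ⁆ x∈)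

extra-point-step : ∀ {n} {Q A : Subset n} {x z : Fin n} →
                   Q ⊆ A → A ⊆ Q ∪ ⁅ x ⁆ → A ∪ ⁅ z ⁆ ⊆ (Q ∪ ⁅ z ⁆) ∪ ⁅ x ⁆
extra-point-step {Q = Q} {x = x} {z} Q⊆A A⊆Q+x =
  ∪-least (⊆-trans A⊆Q+x (∪-monoˡ ⁅ x ⁆ (p⊆p∪q ⁅ z ⁆)))
          (⊆-trans (q⊆p∪q Q ⁅ z ⁆) (p⊆p∪q ⁅ x ⁆))

∉-extra : ∀ {n} {Q A : Subset n} {x w : Fin n} → A ⊆ Q ∪ ⁅ x ⁆ → w ∉ Q → w ≢ x → w ∉ A
∉-extra A⊆Q+x w∉Q w≢x w∈A = Sum.[ w∉Q , w≢x ] (∈-∪⁅⁆⁻ (A⊆Q+x w∈A))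

completes-mono : ∀ (G : AvoidanceGame) {S T : Subset (size G)} →
                 S ⊆ T → Completes G S → Completes G T
completes-mono G S⊆T (L , L∈ , L⊆S) = L , L∈ , ⊆-trans L⊆S S⊆T

reply : ∀ {G : AvoidanceGame} {A B : Subset (size G)} → IWinII G A B →
        ∀ x → x ∉ A → x ∉ B → Completes G (B ∪ ⁅ x ⁆) ⊎ IWinI G A (B ∪ ⁅ x ⁆)
reply (respond _ _ _ options) = options

module _ {n : ℕ} (σ : Permutation′ n) where

  Carries : Subset n → Subset n → Set
  Carries S S′ = ∀ i → (i ∈ S → σ ⟨$⟩ʳ i ∈ S′) × (σ ⟨$⟩ʳ i ∈ S′ → i ∈ S)

  carries-pre : ∀ {S S′ j} → Carries S S′ → j ∈ S′ → σ ⟨$⟩ˡ j ∈ S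
  carries-pre {S′ = S′} c j∈S′ = proj₂ (c _) (subst (_∈ S′) (sym (inverseʳ σ)) j∈S′)

  carries-∉ : ∀ {S S′ i} → Carries S S′ → i ∉ S → σ ⟨$⟩ʳ i ∉ S′
  carries-∉ c i∉S σi∈S′ = i∉S (proj₂ (c _) σi∈S′)

  carries-pre-∉ : ∀ {S S′ j} → Carries S S′ → j ∉ S′ → σ ⟨$⟩ˡ j ∉ S
  carries-pre-∉ {S′ = S′} c j∉S′ σ⁻¹j∈S = j∉S′ (subst (_∈ S′) (inverseʳ σ) (proj₁ (c _) σ⁻¹j∈S))

  carries-⊆ : ∀ {S S′ T T′} → Carries S S′ → Carries T T′ → S ⊆ T → S′ ⊆ T′
  carries-⊆ {T′ = T′} c d S⊆T j∈S′ =
    subst (_∈ T′) (inverseʳ σ) (proj₁ (d _) (S⊆T (carries-pre c j∈S′)))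

  carries-⊇ : ∀ {S S′ T T′} → Carries S S′ → Carries T T′ → S′ ⊆ T′ → S ⊆ T
  carries-⊇ c d S′⊆T′ i∈S = proj₂ (d _) (S′⊆T′ (proj₁ (c _) i∈S))

  carries-⊥ : Carries ⊥ ⊥
  carries-⊥ i = (λ i∈⊥ → ⊥-elim (∉⊥ i∈⊥)) , (λ σi∈⊥ → ⊥-elim (∉⊥ σi∈⊥))

  carries-⁅⁆ : ∀ {i j} → σ ⟨$⟩ʳ i ≡ j → Carries ⁅ i ⁆ ⁅ j ⁆
  carries-⁅⁆ {i} {j} σi≡j k = forward , backward
    where
    forward : k ∈ ⁅ i ⁆ → σ ⟨$⟩ʳ k ∈ ⁅ j ⁆
    forward k∈ rewrite x∈⁅y⁆⇒x≡y i k∈ | σi≡j = x∈⁅x⁆ j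
    backward : σ ⟨$⟩ʳ k ∈ ⁅ j ⁆ → k ∈ ⁅ i ⁆
    backward σk∈ = subst (_∈ ⁅ i ⁆) (sym k≡i) (x∈⁅x⁆ i)
      where
      k≡i : k ≡ i
      k≡i = begin
        k                      ≡⟨ sym (inverseˡ σ) ⟩
        σ ⟨$⟩ˡ (σ ⟨$⟩ʳ k)      ≡⟨ cong (σ ⟨$⟩ˡ_) (trans (x∈⁅y⁆⇒x≡y j σk∈) (sym σi≡j)) ⟩
        σ ⟨$⟩ˡ (σ ⟨$⟩ʳ i)      ≡⟨ inverseˡ σ ⟩
        i                      ∎

  carries-∪ : ∀ {S S′ T T′} → Carries S S′ → Carries T T′ → Carries (S ∪ T) (S′ ∪ T′)
  carries-∪ {S} {S′} {T} {T′} c d i =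
    (λ i∈ → x∈p∪q⁺ (Sum.map (proj₁ (c i)) (proj₁ (d i)) (x∈p∪q⁻ S T i∈))) ,
    (λ σi∈ → x∈p∪q⁺ (Sum.map (proj₂ (c i)) (proj₂ (d i)) (x∈p∪q⁻ S′ T′ σi∈)))

  carries-image : ∀ L → Carries L (image σ L)
  carries-image L i = into , out-of
    where
    lookup-image : ∀ j → lookup (image σ L) j ≡ lookup L (σ ⟨$⟩ˡ j)
    lookup-image j = lookup∘tabulate _ j
    into : i ∈ L → σ ⟨$⟩ʳ i ∈ image σ L
    into i∈L = lookup⇒[]= _ _ (trans (lookup-image _)
                 ([]=⇒lookup (subst (_∈ L) (sym (inverseˡ σ)) i∈L)))
    out-of : σ ⟨$⟩ʳ i ∈ image σ L → i ∈ L
    out-of σi∈ = subst (_∈ L) (inverseˡ σ)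
                   (lookup⇒[]= _ L (trans (sym (lookup-image _)) ([]=⇒lookup σi∈)))

module Symmetry (G : AvoidanceGame) (σ : Permutation′ (size G))
                (automorphism : IsAutomorphism G σ) where

  completes-forward : ∀ {S S′} → Carries σ S S′ → Completes G S → Completes G S′
  completes-forward c (L , L∈ , L⊆S) =
    image σ L , proj₁ automorphism L L∈ , carries-⊆ σ (carries-image σ L) c L⊆S

  completes-backward : ∀ {S S′} → Carries σ S S′ → Completes G S′ → Completes G S
  completes-backward c (L′ , L′∈ , L′⊆S′) with proj₂ automorphism L′ L′∈
  ... | L , L∈ , refl = L , L∈ , carries-⊇ σ (carries-image σ L) c L′⊆S′

  mutual
    transport-I : ∀ {A B A′ B′} → Carries σ A A′ → Carries σ B B′ →
                  IWinI G A B → IWinI G A′ B′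
    transport-I {A} {A′ = A′} cA cB (move x x∉A x∉B safe wins) =
      move (σ ⟨$⟩ʳ x) (carries-∉ σ cA x∉A) (carries-∉ σ cB x∉B)
        (λ completes → safe (completes-backward cA+x completes))
        (transport-II cA+x cB wins)
      where
      cA+x : Carries σ (A ∪ ⁅ x ⁆) (A′ ∪ ⁅ σ ⟨$⟩ʳ x ⁆)
      cA+x = carries-∪ σ cA (carries-⁅⁆ σ refl)

    transport-II : ∀ {A B A′ B′} → Carries σ A A′ → Carries σ B B′ →
                   IWinII G A B → IWinII G A′ B′
    transport-II {B = B} {A′} {B′} cA cB (respond x₀ x₀∉A x₀∉B options) =
      respond (σ ⟨$⟩ʳ x₀) (carries-∉ σ cA x₀∉A) (carries-∉ σ cB x₀∉B) options′
      where
      -- Player II's move x in the image game corresponds to σ⁻¹ x.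
      cB+x : ∀ x → Carries σ (B ∪ ⁅ σ ⟨$⟩ˡ x ⁆) (B′ ∪ ⁅ x ⁆)
      cB+x x = carries-∪ σ cB (carries-⁅⁆ σ (inverseʳ σ))
      options′ : ∀ x → x ∉ A′ → x ∉ B′ → Completes G (B′ ∪ ⁅ x ⁆) ⊎ IWinI G A′ (B′ ∪ ⁅ x ⁆)
      options′ x x∉A′ x∉B′
        with options (σ ⟨$⟩ˡ x) (carries-pre-∉ σ cA x∉A′) (carries-pre-∉ σ cB x∉B′)
      ... | inj₁ completes = inj₁ (completes-forward (cB+x x) completes)
      ... | inj₂ wins      = inj₂ (transport-I cA (cB+x x) wins)

-- Let (P , Q) be a Player I win with Player II to move, and let x be a point
-- that the holder of P can never claim, since P ∪ ⁅ x ⁆ already completes a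
-- line.  If the real Player I holds Q plus at most the point x, and the real
-- Player II holds P, then Player I (to move) cannot win: Player II copies the
-- winning strategy for P, whose moves are never x and hence always legal.
stolen-strategy : ∀ (G : AvoidanceGame) (x : Fin (size G)) {P Q A : Subset (size G)} →
                  IWinII G P Q → Q ⊆ A → A ⊆ Q ∪ ⁅ x ⁆ → Completes G (P ∪ ⁅ x ⁆) →
                  ¬ IWinI G A P
stolen-strategy G x (respond _ _ _ strategy) Q⊆A A⊆Q+x P+x-completes
                (move z z∉A z∉P A+z-safe continuation)
  with strategy z z∉P (λ z∈Q → z∉A (Q⊆A z∈Q))
... | inj₁ Q+z-completes = A+z-safe (completes-mono G (∪-monoˡ ⁅ z ⁆ Q⊆A) Q+z-completes)
... | inj₂ (move w w∉P w∉Q+z P+w-safe strategy′)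
  with reply continuation w (∉-extra (extra-point-step Q⊆A A⊆Q+x) w∉Q+z w≢x) w∉P
  where
  w≢x : w ≢ x
  w≢x refl = P+w-safe P+x-completes
... | inj₁ P+w-completes = P+w-safe P+w-completes
... | inj₂ continuation′ =
  stolen-strategy G x strategy′ (∪-monoˡ ⁅ z ⁆ Q⊆A) (extra-point-step Q⊆A A⊆Q+x)
    (completes-mono G (∪-monoˡ ⁅ x ⁆ (p⊆p∪q ⁅ w ⁆)) P+x-completes) continuation′

size-zero : ∀ {n} (L : Subset n) → ∣ L ∣ ≡ 0 → L ⊆ ⊥
size-zero []            _     ()
size-zero (outside ∷ L) ∣L∣≡0 = out⊆ (size-zero L ∣L∣≡0)

size-one : ∀ {n} (L : Subset n) → ∣ L ∣ ≡ 1 → Σ (Fin n) λ b → L ⊆ ⁅ b ⁆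
size-one (outside ∷ L) ∣L∣≡1 with size-one L ∣L∣≡1
... | b , L⊆b = suc b , out⊆ L⊆b
size-one (inside ∷ L)  ∣L∣≡1 = zero , in⊆in (size-zero L (cong pred ∣L∣≡1))

size-two : ∀ {n} (L : Subset n) → ∣ L ∣ ≡ 2 →
           Σ (Fin n) λ a → Σ (Fin n) λ b → a ≢ b × L ⊆ ⁅ a ⁆ ∪ ⁅ b ⁆
size-two (outside ∷ L) ∣L∣≡2 with size-two L ∣L∣≡2
... | a , b , a≢b , L⊆ab = suc a , suc b , (λ { refl → a≢b refl }) , out⊆ L⊆ab
size-two (inside ∷ L)  ∣L∣≡2 with size-one L (cong pred ∣L∣≡2)
... | b , L⊆b = zero , suc b , (λ ()) , in⊆in (⊆-trans L⊆b (q⊆p∪q ⊥ ⁅ b ⁆))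

partner : ∀ (G : AvoidanceGame) → Transitive G →
          (Σ _ λ L → L ∈ₗ lines G × ∣ L ∣ ≡ 2) →
          ∀ p → Σ (Fin (size G)) λ y → p ≢ y × Completes G (⁅ p ⁆ ∪ ⁅ y ⁆)
partner G transitive (L , L∈ , ∣L∣≡2) p with size-two L ∣L∣≡2
... | a , b , a≢b , L⊆ab with transitive a p
... | σ , automorphism , σa≡p =
  σ ⟨$⟩ʳ b , p≢σb , image σ L , proj₁ automorphism L L∈ ,
  carries-⊆ σ (carries-image σ L) (carries-∪ σ (carries-⁅⁆ σ σa≡p) (carries-⁅⁆ σ refl)) L⊆ab
  where
  p≢σb : p ≢ σ ⟨$⟩ʳ b
  p≢σb p≡σb = a≢b (begin
    a                    ≡⟨ sym (inverseˡ σ) ⟩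
    σ ⟨$⟩ˡ (σ ⟨$⟩ʳ a)    ≡⟨ cong (σ ⟨$⟩ˡ_) (trans σa≡p p≡σb) ⟩
    σ ⟨$⟩ˡ (σ ⟨$⟩ʳ b)    ≡⟨ inverseˡ σ ⟩
    b                    ∎)

-- If {p , y} is a 2-line and an automorphism τ maps p to y, then the opening
-- move p is not winning for Player I: Player II answers at y.
refute-opening : ∀ (G : AvoidanceGame) {p y : Fin (size G)} (τ : Permutation′ (size G)) →
                 IsAutomorphism G τ → τ ⟨$⟩ʳ p ≡ y → p ≢ y →
                 Completes G (⁅ p ⁆ ∪ ⁅ y ⁆) → ¬ Completes G (⊥ ∪ ⁅ p ⁆) →
                 ¬ IWinII G (⊥ ∪ ⁅ p ⁆) ⊥
refute-opening G {p} {y} τ automorphism τp≡y p≢y pair p-safe wins =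
  Sum.[ (λ y-completes → p-safe (completes-backward shift y-completes))
      , stolen-strategy G p mirrored (⊆-min _) ⊆-refl y+p-completes
      ] (reply wins y y∉p ∉⊥)
  where
  open Symmetry G τ automorphism
  shift : Carries τ (⊥ ∪ ⁅ p ⁆) (⊥ ∪ ⁅ y ⁆)
  shift = carries-∪ τ (carries-⊥ τ) (carries-⁅⁆ τ τp≡y)
  y∉p : y ∉ ⊥ ∪ ⁅ p ⁆
  y∉p = ∉-extra ⊆-refl ∉⊥ (λ y≡p → p≢y (sym y≡p))
  -- By symmetry, Player I also wins after opening at y.
  mirrored : IWinII G (⊥ ∪ ⁅ y ⁆) ⊥
  mirrored = transport-II shift (carries-⊥ τ) wins
  -- Player II, holding y, may never claim p.
  y+p-completes : Completes G ((⊥ ∪ ⁅ y ⁆) ∪ ⁅ p ⁆)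
  y+p-completes = completes-mono G (∪-least (q⊆p∪q (⊥ ∪ ⁅ y ⁆) ⁅ p ⁆)
                                            (⊆-trans (q⊆p∪q ⊥ ⁅ y ⁆) (p⊆p∪q ⁅ p ⁆))) pair

theorem3 : (G : AvoidanceGame) → Transitive G →
    (Σ _ λ L → L ∈ₗ lines G × ∣ L ∣ ≡ 2) →
    ¬ PlayerIWin G
theorem3 G transitive two-line (move p _ _ p-safe wins) with partner G transitive two-line p
... | y , p≢y , pair with transitive p y
... | τ , automorphism , τp≡y = refute-opening G τ automorphism τp≡y p≢y pair p-safe wins
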